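{- Let $f(n)$ denote the number of partitions of $n$ in which the nonzero multiplicities of the distinct parts are pairwise different. Then $$\ln f(n)\ge (1+o(1))\,\frac{6^{1/3}}{3}\,n^{1/3}\ln n \qquad\text{as } n\to\infty.$$
   Context: A partition of $n$ can be written as $n=m_1p_1+\cdots+m_rp_r$ where $p_1<\cdots<p_r$ are the distinct parts and $m_i\ge1$ is the multiplicity of $p_i$; $f(n)$ counts those with $m_1,\dots,m_r$ pairwise distinct. -}

module Defs where

open import Data.Nat using (ℕ; zero; suc; _+_; _*_; _≟_)
open import Data.Nat.Properties using ()
open import Data.List using (List; []; _∷_; map; concatMap; upTo; filter; length)
open import Data.Vec using (Vec; []; _∷_; toList)
open import Data.Product using (_×_)
open import Relation.Nullary using (¬_; ¬?)
open import Relation.Nullary.Decidable using (_×-dec_)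
open import Relation.Binary.PropositionalEquality using (_≡_)
import Data.List.Relation.Unary.Unique.DecPropositional as U

-- A partition of n is encoded by its multiplicity vector
--   (m₁, …, mₙ) : Vec ℕ n,  mᵢ = multiplicity of the part i,
-- subject to  1·m₁ + 2·m₂ + … + n·mₙ = n.  (Every part is ≤ n.)

vecs : (k b : ℕ) → List (Vec ℕ k)
vecs zero    b = [] ∷ []
vecs (suc k) b = concatMap (λ x → map (x ∷_) (vecs k b)) (upTo b)

weightFrom : ∀ {k} → ℕ → Vec ℕ k → ℕ
weightFrom s []       = 0
weightFrom s (m ∷ ms) = s * m + weightFrom (suc s) ms

weight : ∀ {k} → Vec ℕ k → ℕ
weight = weightFrom 1

nonzeroMults : ∀ {k} → Vec ℕ k → List ℕ
nonzeroMults m = filter (λ x → ¬? (x ≟ 0)) (toList m)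

GoodPartition : (n : ℕ) → Vec ℕ n → Set
GoodPartition n m = (weight m ≡ n) × U.Unique _≟_ (nonzeroMults m)

-- f n = number of partitions of n with pairwise distinct multiplicities
-- (each multiplicity is ≤ n, so entries range over {0,…,n})
f : ℕ → ℕ
f n = length (filter (λ m → (weight m ≟ n) ×-dec U.unique? _≟_ (nonzeroMults m))
                     (vecs n (suc n)))

-- Cut the parts 1, …, tb into t blocks of b consecutive parts and let the j-th block (from the
-- smallest parts) carry the multiplicities 2 + (t-1-j)b, …, 1 + (t-j)b in any of b! orders; one
-- extra part of multiplicity 1 then completes a partition of n.  All multiplicities are distinct,
-- and since large multiplicities sit on small parts the weight is only about (tb)³/6, so
-- f(n) ≥ (b!)^t as soon as ((t+3)b)³ ≤ 6n.  With n ≈ u^D, D = 3ℓ + 4, b = u^(ℓ+1) and t maximal,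
-- b! ≥ (u^ℓ)^(b - b/u) gives  ln f(n) ≳ ℓ·tb·ln u ≈ (ℓ/D)·(6n)^(1/3)·ln n,  and ℓ/D → 1/3.
module Submission where

open import Defs
open import Data.Nat using (ℕ; zero; suc; _+_; _*_; _^_; _∸_; _≤_; _<_; _≟_; _≤?_; _<?_; _!; z≤n; s≤s; s≤s⁻¹)
open import Data.Nat.Properties
open import Data.Nat.Tactic.RingSolver using (solve-∀)
open import Data.Fin using (Fin; toℕ; punchIn)
open import Data.Fin.Properties using (toℕ<n; toℕ-injective; punchIn-injective; punchInᵢ≢i)
open import Data.Vec as Vec using (Vec; []; _∷_; toList; padRight; truncate; [_])
import Data.Vec.Properties as Vecₚ
open import Data.List as List using (List; []; _∷_; _++_; length; allFin; cartesianProductWith)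
open import Data.List.Properties using (length-++; length-map; length-tabulate; filter-++; filter-all)
open import Data.List.Membership.Propositional using (_∈_)
open import Data.List.Membership.Propositional.Properties using (∈-∃++; ∈-filter⁺; ∈-map⁺; ∈-concatMap⁺; ∈-upTo⁺)
open import Data.List.Relation.Binary.Subset.Propositional using (_⊆_)
open import Data.List.Relation.Unary.Any as Any using (here; there)
open import Data.List.Relation.Unary.All as All using (All; []; _∷_)
import Data.List.Relation.Unary.All.Properties as Allₚ
open import Data.List.Relation.Unary.AllPairs using ([]; _∷_)
open import Data.List.Relation.Unary.Unique.Propositional using (Unique)
import Data.List.Relation.Unary.Unique.Propositional.Properties as Uniqueₚ
import Data.List.Relation.Unary.Unique.DecPropositional as DecUnique
open import Data.Product using (_×_; _,_; proj₁; proj₂; ∃-syntax)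
open import Data.Empty using (⊥-elim)
open import Function using (_∘_)
open import Relation.Nullary using (¬_; yes; no)
open import Relation.Nullary.Decidable using (_×-dec_)
open import Relation.Unary using (Decidable)
open import Relation.Binary.PropositionalEquality
  using (_≡_; _≢_; refl; sym; trans; cong; cong₂; subst; setoid; module ≡-Reasoning)

module _ {A : Set} where

  ∈-++-∷⁻ : ∀ {x y : A} ys zs → y ∈ ys ++ x ∷ zs → x ≢ y → y ∈ ys ++ zs
  ∈-++-∷⁻ []       zs (here refl) x≢y = ⊥-elim (x≢y refl)
  ∈-++-∷⁻ []       zs (there y∈)  x≢y = y∈
  ∈-++-∷⁻ (w ∷ ys) zs (here refl) x≢y = here refl
  ∈-++-∷⁻ (w ∷ ys) zs (there y∈)  x≢y = there (∈-++-∷⁻ ys zs y∈ x≢y)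

  length-++-∷ : ∀ (x : A) ys zs → length (ys ++ x ∷ zs) ≡ suc (length (ys ++ zs))
  length-++-∷ x []       zs = refl
  length-++-∷ x (y ∷ ys) zs = cong suc (length-++-∷ x ys zs)

  Unique-⊆⇒length≤ : ∀ {xs ys : List A} → Unique xs → xs ⊆ ys → length xs ≤ length ys
  Unique-⊆⇒length≤ {[]}     _            _     = z≤n
  Unique-⊆⇒length≤ {x ∷ xs} (x∉xs ∷ !xs) xs⊆ys with ∈-∃++ (xs⊆ys (here refl))
  ... | ys₁ , ys₂ , refl = subst (suc (length xs) ≤_) (sym (length-++-∷ x ys₁ ys₂))
    (s≤s (Unique-⊆⇒length≤ !xs λ y∈xs →
      ∈-++-∷⁻ ys₁ ys₂ (xs⊆ys (there y∈xs)) (All.lookup x∉xs y∈xs)))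

length-cartesianProductWith : ∀ {A B C : Set} (f : A → B → C) xs ys →
                              length (cartesianProductWith f xs ys) ≡ length xs * length ys
length-cartesianProductWith f []       ys = refl
length-cartesianProductWith f (x ∷ xs) ys = begin
  length (List.map (f x) ys ++ cartesianProductWith f xs ys)         ≡⟨ length-++ (List.map (f x) ys) ⟩
  length (List.map (f x) ys) + length (cartesianProductWith f xs ys) ≡⟨ cong₂ _+_ (length-map (f x) ys)
                                                                                   (length-cartesianProductWith f xs ys) ⟩
  length ys + length xs * length ys                                  ∎
  where open ≡-Reasoning

Vec-map-injective : ∀ {A B : Set} {f : A → B} → (∀ {x y} → f x ≡ f y → x ≡ y) →
                    ∀ {n} {xs ys : Vec A n} → Vec.map f xs ≡ Vec.map f ys → xs ≡ ys
Vec-map-injective f-inj {xs = []}     {[]}     _  = refl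
Vec-map-injective f-inj {xs = x ∷ xs} {y ∷ ys} eq =
  cong₂ _∷_ (f-inj (Vecₚ.∷-injectiveˡ eq)) (Vec-map-injective f-inj (Vecₚ.∷-injectiveʳ eq))

-- Multiplicity vectors

weightFrom-++ : ∀ {m k} s (xs : Vec ℕ m) (ys : Vec ℕ k) →
                weightFrom s (xs Vec.++ ys) ≡ weightFrom s xs + weightFrom (s + m) ys
weightFrom-++         s []       ys = cong (λ r → weightFrom r ys) (sym (+-identityʳ s))
weightFrom-++ {suc m} s (x ∷ xs) ys = begin
  s * x + weightFrom (suc s) (xs Vec.++ ys)                    ≡⟨ cong (s * x +_) (weightFrom-++ (suc s) xs ys) ⟩
  s * x + (weightFrom (suc s) xs + weightFrom (suc s + m) ys)  ≡⟨ +-assoc (s * x) _ _ ⟨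
  s * x + weightFrom (suc s) xs + weightFrom (suc s + m) ys    ≡⟨ cong (λ r → s * x + weightFrom (suc s) xs + weightFrom r ys)
                                                                       (+-suc s m) ⟨
  s * x + weightFrom (suc s) xs + weightFrom (s + suc m) ys    ∎
  where open ≡-Reasoning

weightFrom-≤ : ∀ {m} M s (xs : Vec ℕ m) → All (_≤ M) (toList xs) → weightFrom s xs ≤ m * ((s + m) * M)
weightFrom-≤         M s []       _            = z≤n
weightFrom-≤ {suc m} M s (x ∷ xs) (x≤M ∷ xs≤M) = +-mono-≤
  (*-mono-≤ (m≤m+n s (suc m)) x≤M)
  (subst (λ r → weightFrom (suc s) xs ≤ m * (r * M)) (sym (+-suc s m)) (weightFrom-≤ M (suc s) xs xs≤M))

weightFrom-replicate-0 : ∀ s k → weightFrom s (Vec.replicate k 0) ≡ 0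
weightFrom-replicate-0 s zero    = refl
weightFrom-replicate-0 s (suc k) = cong₂ _+_ (*-zeroʳ s) (weightFrom-replicate-0 (suc s) k)

weightFrom-padRight-0 : ∀ {m n} s (p : m ≤ n) (xs : Vec ℕ m) → weightFrom s (padRight p 0 xs) ≡ weightFrom s xs
weightFrom-padRight-0 {n = n} s z≤n     []       = weightFrom-replicate-0 s n
weightFrom-padRight-0         s (s≤s p) (x ∷ xs) = cong (s * x +_) (weightFrom-padRight-0 (suc s) p xs)

entries≤weightFrom : ∀ {k} s (v : Vec ℕ k) → All (_≤ weightFrom (suc s) v) (toList v)
entries≤weightFrom s []      = []
entries≤weightFrom s (x ∷ v) = ≤-trans (m≤n*m x (suc s)) (m≤m+n _ _)
  ∷ All.map (λ m≤ → ≤-trans m≤ (m≤n+m _ (suc s * x))) (entries≤weightFrom (suc s) v)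

nonzeroMults-++ : ∀ {m k} (xs : Vec ℕ m) (ys : Vec ℕ k) →
                  nonzeroMults (xs Vec.++ ys) ≡ nonzeroMults xs ++ nonzeroMults ys
nonzeroMults-++ xs ys = trans (cong (List.filter _) (Vecₚ.toList-++ xs ys)) (filter-++ _ (toList xs) (toList ys))

nonzeroMults-replicate-0 : ∀ k → nonzeroMults (Vec.replicate k 0) ≡ []
nonzeroMults-replicate-0 zero    = refl
nonzeroMults-replicate-0 (suc k) = nonzeroMults-replicate-0 k

nonzeroMults-padRight-0 : ∀ {m n} (p : m ≤ n) (xs : Vec ℕ m) → nonzeroMults (padRight p 0 xs) ≡ nonzeroMults xs
nonzeroMults-padRight-0 {n = n} z≤n     []           = nonzeroMults-replicate-0 n
nonzeroMults-padRight-0         (s≤s p) (zero  ∷ xs) = nonzeroMults-padRight-0 p xs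
nonzeroMults-padRight-0         (s≤s p) (suc x ∷ xs) = cong (suc x ∷_) (nonzeroMults-padRight-0 p xs)

truncate-padRight-++ : ∀ {A : Set} {m k n} (q : m ≤ n) (p : m + k ≤ n) (z : A) (xs : Vec A m) (ys : Vec A k) →
                       truncate q (padRight p z (xs Vec.++ ys)) ≡ xs
truncate-padRight-++ q       p       z []       ys = refl
truncate-padRight-++ (s≤s q) (s≤s p) z (x ∷ xs) ys = cong (x ∷_) (truncate-padRight-++ q p z xs ys)

∈-vecs : ∀ {k b} (v : Vec ℕ k) → All (_< b) (toList v) → v ∈ vecs k b
∈-vecs             []      _           = here refl
∈-vecs {suc k} {b} (x ∷ v) (x<b ∷ v<b) = ∈-concatMap⁺ (λ y → List.map (y ∷_) (vecs k b))
  (Any.map (λ { refl → ∈-map⁺ (x ∷_) (∈-vecs v v<b) }) (∈-upTo⁺ x<b))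

GoodPartition⇒∈filter : ∀ {n} {v : Vec ℕ n} → GoodPartition n v →
  v ∈ List.filter (λ m → (weight m ≟ n) ×-dec DecUnique.unique? _≟_ (nonzeroMults m)) (vecs n (suc n))
GoodPartition⇒∈filter {n} {v} good@(weight≡n , _) =
  ∈-filter⁺ _ (∈-vecs v (All.map (λ m≤w → s≤s (subst (_ ≤_) weight≡n m≤w)) (entries≤weightFrom 0 v))) good

Unique-GoodPartition⇒length≤f : ∀ {n} {vs : List (Vec ℕ n)} → Unique vs → All (GoodPartition n) vs → length vs ≤ f n
Unique-GoodPartition⇒length≤f !vs goods = Unique-⊆⇒length≤ !vs (GoodPartition⇒∈filter ∘ All.lookup goods)

DistinctIn : ℕ → ℕ → List ℕ → Set
DistinctIn l h ms = Unique ms × All (λ m → l ≤ m × m < h) ms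

DistinctIn-++ : ∀ {l c h us vs} → l ≤ c → c ≤ h →
                DistinctIn c h us → DistinctIn l c vs → DistinctIn l h (us ++ vs)
DistinctIn-++ l≤c c≤h (!us , us∈) (!vs , vs∈) =
  Uniqueₚ.++⁺ !us !vs
    (λ (m∈us , m∈vs) → <⇒≱ (proj₂ (All.lookup vs∈ m∈vs)) (proj₁ (All.lookup us∈ m∈us))) ,
  Allₚ.++⁺ (All.map (λ (c≤m , m<h) → ≤-trans l≤c c≤m , m<h) us∈)
           (All.map (λ (l≤m , m<c) → l≤m , <-≤-trans m<c c≤h) vs∈)

gap : ∀ {m} → ℕ → Vec ℕ m → ℕ
gap {m} n x = n ∸ weight x ∸ suc m

gap-fits : ∀ {m n} → m < n → (x : Vec ℕ m) → m + (gap n x + 1) ≤ n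
gap-fits {m} {n} m<n x with suc m ≤? n ∸ weight x
... | yes m<n∸w = begin
  m + (gap n x + 1)   ≡⟨ swap m (gap n x) ⟩
  gap n x + suc m     ≡⟨ m∸n+n≡m m<n∸w ⟩
  n ∸ weight x        ≤⟨ m∸n≤m n (weight x) ⟩
  n                   ∎
  where
  open ≤-Reasoning
  swap : ∀ m a → m + (a + 1) ≡ a + suc m
  swap = solve-∀
... | no  m≮n∸w = subst (λ a → m + (a + 1) ≤ n) (sym (m≤n⇒m∸n≡0 (<⇒≤ (≰⇒> m≮n∸w))))
                        (subst (_≤ n) (+-comm 1 m) m<n)

-- Parts 1, …, m get the multiplicities x and the part n ∸ weight x (at position m + gap + 1)
-- gets multiplicity 1.
complete : ∀ {m} n → m < n → Vec ℕ m → Vec ℕ n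
complete n m<n x = padRight (gap-fits m<n x) 0 (x Vec.++ (Vec.replicate (gap n x) 0 Vec.++ [ 1 ]))

complete-injective : ∀ {m n} (m<n : m < n) {x y : Vec ℕ m} → complete n m<n x ≡ complete n m<n y → x ≡ y
complete-injective m<n {x} {y} eq = begin
  x                                      ≡⟨ truncate-padRight-++ (<⇒≤ m<n) (gap-fits m<n x) 0 x _ ⟨
  truncate (<⇒≤ m<n) (complete _ m<n x)  ≡⟨ cong (truncate (<⇒≤ m<n)) eq ⟩
  truncate (<⇒≤ m<n) (complete _ m<n y)  ≡⟨ truncate-padRight-++ (<⇒≤ m<n) (gap-fits m<n y) 0 y _ ⟩
  y                                      ∎
  where open ≡-Reasoning

weight-complete : ∀ {m n} (m<n : m < n) (x : Vec ℕ m) → suc m + weight x ≤ n → weight (complete n m<n x) ≡ n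
weight-complete {m} {n} m<n x fits = begin
  weight (complete n m<n x)
    ≡⟨ weightFrom-padRight-0 1 (gap-fits m<n x) (x Vec.++ rest) ⟩
  weightFrom 1 (x Vec.++ rest)
    ≡⟨ weightFrom-++ 1 x rest ⟩
  w + weightFrom (suc m) rest
    ≡⟨ cong (w +_) (weightFrom-++ (suc m) zeros [ 1 ]) ⟩
  w + (weightFrom (suc m) zeros + ((suc m + a) * 1 + 0))
    ≡⟨ cong (λ r → w + (r + ((suc m + a) * 1 + 0))) (weightFrom-replicate-0 (suc m) a) ⟩
  w + ((suc m + a) * 1 + 0)
    ≡⟨ cong (w +_) lastPart ⟩
  w + (n ∸ w)
    ≡⟨ m+[n∸m]≡n (m+n≤o⇒n≤o (suc m) fits) ⟩
  n
    ∎
  where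
  open ≡-Reasoning
  w = weight x
  a = gap n x
  zeros = Vec.replicate a 0
  rest = zeros Vec.++ [ 1 ]
  lastPart : (suc m + a) * 1 + 0 ≡ n ∸ w
  lastPart = trans (+-identityʳ _) (trans (*-identityʳ _)
               (trans (+-comm (suc m) a) (m∸n+n≡m (m+n≤o⇒m≤o∸n (suc m) fits))))

nonzeroMults-complete : ∀ {m n} (m<n : m < n) (x : Vec ℕ m) → All (_≢ 0) (toList x) →
                        nonzeroMults (complete n m<n x) ≡ toList x ++ 1 ∷ []
nonzeroMults-complete {m} {n} m<n x x≢0 = begin
  nonzeroMults (complete n m<n x)
    ≡⟨ nonzeroMults-padRight-0 (gap-fits m<n x) (x Vec.++ rest) ⟩
  nonzeroMults (x Vec.++ rest)
    ≡⟨ nonzeroMults-++ x rest ⟩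
  nonzeroMults x ++ nonzeroMults rest
    ≡⟨ cong₂ _++_ (filter-all _ x≢0) (nonzeroMults-++ (Vec.replicate a 0) [ 1 ]) ⟩
  toList x ++ nonzeroMults (Vec.replicate a 0) ++ 1 ∷ []
    ≡⟨ cong (λ l → toList x ++ l ++ 1 ∷ []) (nonzeroMults-replicate-0 a) ⟩
  toList x ++ 1 ∷ []
    ∎
  where
  open ≡-Reasoning
  a = gap n x
  rest = Vec.replicate a 0 Vec.++ [ 1 ]

complete-good : ∀ {m n h} (m<n : m < n) (x : Vec ℕ m) → DistinctIn 2 h (toList x) → suc m + weight x ≤ n →
                GoodPartition n (complete n m<n x)
complete-good m<n x (!x , x∈) fits = weight-complete m<n x fits ,
  subst (DecUnique.Unique _≟_) (sym (nonzeroMults-complete m<n x (All.map (λ { (s≤s (s≤s _) , _) () }) x∈)))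
    (Uniqueₚ.++⁺ !x ([] ∷ []) λ { (1∈x , here refl) → ≤⇒≯ (proj₁ (All.lookup x∈ 1∈x)) ≤-refl })

-- Permuted blocks

permutations : (m : ℕ) → List (Vec (Fin m) m)
permutations zero    = [] ∷ []
permutations (suc m) = cartesianProductWith (λ i π → i ∷ Vec.map (punchIn i) π) (allFin (suc m)) (permutations m)

length-permutations : ∀ m → length (permutations m) ≡ m !
length-permutations zero    = refl
length-permutations (suc m) = trans (length-cartesianProductWith _ (allFin (suc m)) (permutations m))
  (cong₂ _*_ (length-tabulate {n = suc m} (λ i → i)) (length-permutations m))

permutations-unique : ∀ m → Unique (permutations m)
permutations-unique zero    = [] ∷ []
permutations-unique (suc m) =
  Uniqueₚ.cartesianProductWith⁺ _ injective (Uniqueₚ.allFin⁺ (suc m)) (permutations-unique m)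
  where
  injective : ∀ {i j π ρ} → i ∷ Vec.map (punchIn i) π ≡ j ∷ Vec.map (punchIn j) ρ → i ≡ j × π ≡ ρ
  injective {i} eq with Vecₚ.∷-injective eq
  ... | refl , eq′ = refl , Vec-map-injective (punchIn-injective i _ _) eq′

permutation-unique : ∀ m → All (Unique ∘ toList) (permutations m)
permutation-unique zero    = [] ∷ []
permutation-unique (suc m) = Allₚ.cartesianProductWith⁺ (setoid _) (setoid _) _ (allFin (suc m)) (permutations m)
  λ {i} {π} _ π∈ → subst (λ l → Unique (i ∷ l)) (sym (Vecₚ.toList-map (punchIn i) π))
    (Allₚ.map⁺ (All.universal (λ j → punchInᵢ≢i i j ∘ sym) (toList π))
     ∷ Uniqueₚ.map⁺ (punchIn-injective i _ _) (All.lookup (permutation-unique m) π∈))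

offset : ∀ {b} → ℕ → Vec (Fin b) b → Vec ℕ b
offset c π = Vec.map (λ j → c + toℕ j) π

offset-injective : ∀ {b} c {π ρ : Vec (Fin b) b} → offset c π ≡ offset c ρ → π ≡ ρ
offset-injective c = Vec-map-injective (toℕ-injective ∘ +-cancelˡ-≡ c _ _)

offset-distinct : ∀ {b} c {π : Vec (Fin b) b} → Unique (toList π) → DistinctIn c (c + b) (toList (offset c π))
offset-distinct c {π} !π rewrite Vecₚ.toList-map (λ j → c + toℕ j) π =
  Uniqueₚ.map⁺ (toℕ-injective ∘ +-cancelˡ-≡ c _ _) !π ,
  Allₚ.map⁺ (All.universal (λ j → m≤m+n c (toℕ j) , +-monoʳ-< c (toℕ<n j)) (toList π))

family : (b t : ℕ) → List (Vec ℕ (t * b))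
family b zero    = [] ∷ []
family b (suc t) = cartesianProductWith (λ π x → offset (2 + t * b) π Vec.++ x) (permutations b) (family b t)

2+tb+b≡2+[1+t]b : ∀ b t → 2 + t * b + b ≡ 2 + suc t * b
2+tb+b≡2+[1+t]b b t = trans (+-assoc 2 (t * b) b) (cong (2 +_) (+-comm (t * b) b))

length-family : ∀ b t → length (family b t) ≡ (b !) ^ t
length-family b zero    = refl
length-family b (suc t) = trans (length-cartesianProductWith _ (permutations b) (family b t))
  (cong₂ _*_ (length-permutations b) (length-family b t))

family-unique : ∀ b t → Unique (family b t)
family-unique b zero    = [] ∷ []
family-unique b (suc t) =
  Uniqueₚ.cartesianProductWith⁺ _ injective (permutations-unique b) (family-unique b t)
  where
  injective : ∀ {π ρ x y} → offset (2 + t * b) π Vec.++ x ≡ offset (2 + t * b) ρ Vec.++ y → π ≡ ρ × x ≡ y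
  injective eq with Vecₚ.++-injective (offset (2 + t * b) _) (offset (2 + t * b) _) eq
  ... | eqˡ , eqʳ = offset-injective (2 + t * b) eqˡ , eqʳ

family-distinct : ∀ b t → All (DistinctIn 2 (2 + t * b) ∘ toList) (family b t)
family-distinct b zero    = ([] , []) ∷ []
family-distinct b (suc t) = Allₚ.cartesianProductWith⁺ (setoid _) (setoid _) _ (permutations b) (family b t)
  λ {π} {x} π∈ x∈ → subst (DistinctIn 2 _) (sym (Vecₚ.toList-++ (offset c π) x))
    (DistinctIn-++ (m≤m+n 2 (t * b)) (subst (c ≤_) (2+tb+b≡2+[1+t]b b t) (m≤m+n c b))
      (subst (λ h → DistinctIn c h (toList (offset c π))) (2+tb+b≡2+[1+t]b b t)
             (offset-distinct c (All.lookup (permutation-unique b) π∈)))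
      (All.lookup (family-distinct b t) x∈))
  where
  c = 2 + t * b

familyWeightBound : (b t o : ℕ) → ℕ
familyWeightBound b t o =
  t * b * (t * b * (t * b) + 3 * (t * b) * (b + o + 2) + (2 * b * b + 3 * o * b + 6 * b + 6 * o + 6))

familyWeightBound-suc : ∀ b t o →
  6 * (b * ((suc o + b) * (1 + suc t * b))) + familyWeightBound b t (o + b) ≡ familyWeightBound b (suc t) o
familyWeightBound-suc = identity
  where
  identity : ∀ b t o → 6 * (b * ((suc o + b) * (1 + (b + t * b))))
      + t * b * (t * b * (t * b) + 3 * (t * b) * (b + (o + b) + 2) + (2 * b * b + 3 * (o + b) * b + 6 * b + 6 * (o + b) + 6))
    ≡ (b + t * b) * ((b + t * b) * (b + t * b) + 3 * (b + t * b) * (b + o + 2) + (2 * b * b + 3 * o * b + 6 * b + 6 * o + 6))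
  identity = solve-∀

family-weight : ∀ b t → All (λ x → ∀ o → 6 * weightFrom (suc o) x ≤ familyWeightBound b t o) (family b t)
family-weight b zero    = (λ o → z≤n) ∷ []
family-weight b (suc t) = Allₚ.cartesianProductWith⁺ (setoid _) (setoid _) _ (permutations b) (family b t)
  λ {π} {x} π∈ x∈ o → begin
    6 * weightFrom (suc o) (offset c π Vec.++ x)
      ≡⟨ cong (6 *_) (weightFrom-++ (suc o) (offset c π) x) ⟩
    6 * (weightFrom (suc o) (offset c π) + weightFrom (suc (o + b)) x)
      ≡⟨ *-distribˡ-+ 6 (weightFrom (suc o) (offset c π)) _ ⟩
    6 * weightFrom (suc o) (offset c π) + 6 * weightFrom (suc (o + b)) x
      ≤⟨ +-mono-≤ (*-monoʳ-≤ 6 (weightFrom-≤ (1 + suc t * b) (suc o) (offset c π) (block≤ π∈)))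
                  (All.lookup (family-weight b t) x∈ (o + b)) ⟩
    6 * (b * ((suc o + b) * (1 + suc t * b))) + familyWeightBound b t (o + b)
      ≡⟨ familyWeightBound-suc b t o ⟩
    familyWeightBound b (suc t) o
      ∎
  where
  open ≤-Reasoning
  c = 2 + t * b
  block≤ : ∀ {π} → π ∈ permutations b → All (_≤ 1 + suc t * b) (toList (offset c π))
  block≤ π∈ = All.map (λ {m} (_ , m<c+b) → s≤s⁻¹ (subst (m <_) (2+tb+b≡2+[1+t]b b t) m<c+b))
                      (proj₂ (offset-distinct c (All.lookup (permutation-unique b) π∈)))

familyWeightBound+6[1+tb]≤cube : ∀ b t → 1 ≤ b → familyWeightBound b t 0 + 6 * suc (t * b) ≤ ((3 + t) * b) ^ 3
familyWeightBound+6[1+tb]≤cube (suc c) t _ = begin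
  familyWeightBound (suc c) t 0 + 6 * suc (t * suc c)      ≤⟨ m≤m+n _ _ ⟩
  familyWeightBound (suc c) t 0 + 6 * suc (t * suc c) + _  ≡⟨ identity c t ⟨
  ((3 + t) * suc c) ^ 3                                    ∎
  where
  open ≤-Reasoning
  identity : ∀ c t → (3 + t) * suc c * ((3 + t) * suc c * ((3 + t) * suc c * 1)) ≡
    t * suc c * (t * suc c * (t * suc c) + 3 * (t * suc c) * (suc c + 0 + 2)
                 + (2 * suc c * suc c + 3 * 0 * suc c + 6 * suc c + 6 * 0 + 6))
    + 6 * suc (t * suc c)
    + (6 * c * (t * suc c) * (t * suc c) + (7 + 44 * c + 25 * c * c) * (t * suc c)
       + (21 + 81 * c + 81 * c * c + 27 * c * c * c))
  identity = solve-∀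

family-fits : ∀ b t {n w} → 1 ≤ b → ((3 + t) * b) ^ 3 ≤ 6 * n → 6 * w ≤ familyWeightBound b t 0 →
              suc (t * b) + w ≤ n
family-fits b t {n} {w} 1≤b cube≤6n 6w≤ = *-cancelˡ-≤ 6 (begin
  6 * (suc (t * b) + w)                      ≡⟨ *-distribˡ-+ 6 (suc (t * b)) w ⟩
  6 * suc (t * b) + 6 * w                    ≤⟨ +-monoʳ-≤ (6 * suc (t * b)) 6w≤ ⟩
  6 * suc (t * b) + familyWeightBound b t 0  ≡⟨ +-comm (6 * suc (t * b)) _ ⟩
  familyWeightBound b t 0 + 6 * suc (t * b)  ≤⟨ familyWeightBound+6[1+tb]≤cube b t 1≤b ⟩
  ((3 + t) * b) ^ 3                          ≤⟨ cube≤6n ⟩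
  6 * n                                      ∎)
  where open ≤-Reasoning

factorial^t≤f : ∀ {n} b t → 1 ≤ b → ((3 + t) * b) ^ 3 ≤ 6 * n → (b !) ^ t ≤ f n
factorial^t≤f {n} b t 1≤b cube≤6n = subst (_≤ f n) (trans (length-map _ (family b t)) (length-family b t))
  (Unique-GoodPartition⇒length≤f (Uniqueₚ.map⁺ (complete-injective tb<n) (family-unique b t))
    (Allₚ.map⁺ (All.tabulate λ {x} x∈ → complete-good tb<n x (All.lookup (family-distinct b t) x∈)
                                          (family-fits b t 1≤b cube≤6n (All.lookup (family-weight b t) x∈ 0)))))
  where
  tb<n : t * b < n
  tb<n = m+n≤o⇒m≤o (suc (t * b)) (family-fits b t {w = 0} 1≤b cube≤6n z≤n)

-- Choice of parameters

crossing : ∀ (P : ℕ → Set) → Decidable P → P 0 → ∀ M → ¬ P M → ∃[ w ] P w × ¬ P (suc w)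
crossing P P? p0 zero    ¬pM = ⊥-elim (¬pM p0)
crossing P P? p0 (suc M) ¬pM with P? M
... | yes pM   = M , pM , ¬pM
... | no  ¬pM′ = crossing P P? p0 M ¬pM′

^-distribʳ-* : ∀ m n o → (m * n) ^ o ≡ m ^ o * n ^ o
^-distribʳ-* m n zero    = refl
^-distribʳ-* m n (suc o) = trans (cong (m * n *_) (^-distribʳ-* m n o)) (interchange m n (m ^ o) (n ^ o))
  where
  interchange : ∀ m n p q → m * n * (p * q) ≡ m * p * (n * q)
  interchange = solve-∀

m≤m^[1+n] : ∀ m n → 1 ≤ m → m ≤ m ^ suc n
m≤m^[1+n] (suc m) n _ = subst (_≤ suc m ^ suc n) (*-identityʳ (suc m)) (*-monoʳ-≤ (suc m) (m^n>0 (suc m) n))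

m<[[1+m]*n]^3 : ∀ m n → 1 ≤ n → m < (suc m * n) ^ 3
m<[[1+m]*n]^3 m (suc n) _ = ≤-trans (m≤m*n (suc m) (suc n)) (m≤m^[1+n] (suc m * suc n) 2 (s≤s z≤n))

m^n≤[m+n]! : ∀ m n → m ^ n ≤ (m + n) !
m^n≤[m+n]! m zero    = 1≤n! (m + 0)
m^n≤[m+n]! m (suc n) = subst (λ r → m * m ^ n ≤ r !) (sym (+-suc m n))
  (*-mono-≤ (≤-trans (m≤m+n m n) (n≤1+n (m + n))) (m^n≤[m+n]! m n))

root-bracket : ∀ {C n} d → C ^ suc d < n → ∃[ v ] C ≤ v × v ^ suc d < n × n ≤ suc v ^ suc d
root-bracket {C} {n} d Cᴰ<n
  with crossing (λ v → v ^ suc d < n) (λ v → v ^ suc d <? n) (≤-<-trans (^-monoˡ-≤ (suc d) (z≤n {C})) Cᴰ<n) n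
                (λ nᴰ<n → <⇒≱ nᴰ<n (m≤m^[1+n] n d (≤-trans (s≤s z≤n) Cᴰ<n)))
... | v , vᴰ<n , uᴰ≮n =
  v , ≮⇒≥ (λ v<C → uᴰ≮n (≤-<-trans (^-monoˡ-≤ (suc d) v<C) Cᴰ<n)) , vᴰ<n , ≮⇒≥ uᴰ≮n

block-count-bracket : ∀ {n b H} → 1 ≤ b → 3 ≤ H → (H * b) ^ 3 ≤ 6 * n →
                      ∃[ t ] H ≤ 3 + t × ((3 + t) * b) ^ 3 ≤ 6 * n × 6 * n < ((4 + t) * b) ^ 3
block-count-bracket {n} {b} {H} 1≤b 3≤H Hb≤6n
  with crossing (λ w → (w * b) ^ 3 ≤ 6 * n) (λ w → (w * b) ^ 3 ≤? 6 * n) z≤n (suc (6 * n))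
                (<⇒≱ (m<[[1+m]*n]^3 (6 * n) b 1≤b))
... | w , wb≤6n , wb≰6n = w ∸ 3 ,
  subst (λ r → H ≤ r × (r * b) ^ 3 ≤ 6 * n × 6 * n < (suc r * b) ^ 3) (sym (m+[n∸m]≡n (≤-trans 3≤H H≤w)))
        (H≤w , wb≤6n , ≰⇒> wb≰6n)
  where
  H≤w : H ≤ w
  H≤w = ≮⇒≥ (λ w<H → wb≰6n (≤-trans (^-monoˡ-≤ 3 (*-monoˡ-≤ b w<H)) Hb≤6n))

A*[4+t]*[1+v]≤B*v*t : ∀ A B t v → 16 * A ≤ t → 2 * A ≤ v → 1 ≤ v → suc A ≤ B →
                      A * (4 + t) * suc v ≤ B * v * t
A*[4+t]*[1+v]≤B*v*t A B t v 16A≤t 2A≤v 1≤v 1+A≤B = *-cancelˡ-≤ 2 (begin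
  2 * (A * (4 + t) * suc v)                        ≡⟨ expand A t v ⟩
  2 * A * v * t + 2 * A * t + (8 * A * v + 8 * A)  ≤⟨ +-mono-≤ (+-monoʳ-≤ _ (*-monoˡ-≤ t 2A≤v)) small ⟩
  2 * A * v * t + v * t + t * v                    ≡⟨ collect A t v ⟩
  2 * (suc A * v * t)                              ≤⟨ *-monoʳ-≤ 2 (*-monoˡ-≤ t (*-monoˡ-≤ v 1+A≤B)) ⟩
  2 * (B * v * t)                                  ∎)
  where
  open ≤-Reasoning
  expand : ∀ A t v → 2 * (A * (4 + t) * suc v) ≡ 2 * A * v * t + 2 * A * t + (8 * A * v + 8 * A)
  expand = solve-∀
  collect : ∀ A t v → 2 * A * v * t + v * t + t * v ≡ 2 * (suc A * v * t)
  collect = solve-∀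
  double : ∀ A v → 8 * A * v + 8 * A * v ≡ 16 * A * v
  double = solve-∀
  small : 8 * A * v + 8 * A ≤ t * v
  small = begin
    8 * A * v + 8 * A      ≤⟨ +-monoʳ-≤ (8 * A * v)
                                (subst (_≤ 8 * A * v) (*-identityʳ (8 * A)) (*-monoʳ-≤ (8 * A) 1≤v)) ⟩
    8 * A * v + 8 * A * v  ≡⟨ double A v ⟩
    16 * A * v             ≤⟨ *-monoˡ-≤ v 16A≤t ⟩
    t * v                  ∎

-- For n ≤ (1 + v)^D, block size b = (1 + v)^(ℓ+1) and t blocks, (b!)^t ≥ (1 + v)^(E v t), and
-- E v t / D is about (ℓ/D)·(6n)^(1/3).  Taking ℓ = 2k + 1 and D = 3ℓ + 4 makes kD < 3(k + 1)ℓ,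
-- so this beats (k/(3(k + 1)))·(6n)^(1/3) once v ≥ C and t ≥ H - 3.
module Parameters (k : ℕ) where

  ℓ D A H K C : ℕ
  ℓ = 2 * k + 1
  D = suc (suc ℓ * 3)
  A = k * D
  H = 16 * A + 3
  K = H ^ 3 * 2 ^ (suc ℓ * 3)
  C = suc (K + 2 * A)

  blockSize : ℕ → ℕ
  blockSize v = suc v ^ suc ℓ

  E : ℕ → ℕ → ℕ
  E v t = ℓ * (v * suc v ^ ℓ) * t

  1≤v : ∀ {v} → C ≤ v → 1 ≤ v
  1≤v C≤v = ≤-trans (s≤s z≤n) C≤v

  2A≤v : ∀ {v} → C ≤ v → 2 * A ≤ v
  2A≤v C≤v = ≤-trans (m≤n+m (2 * A) K) (<⇒≤ C≤v)

  H-blocks-fit : ∀ {n v} → C ≤ v → v ^ D < n → (H * blockSize v) ^ 3 ≤ 6 * n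
  H-blocks-fit {n} {v} C≤v vᴰ<n = begin
    (H * blockSize v) ^ 3    ≡⟨ ^-distribʳ-* H (blockSize v) 3 ⟩
    H ^ 3 * blockSize v ^ 3  ≡⟨ cong (H ^ 3 *_) (^-*-assoc (suc v) (suc ℓ) 3) ⟩
    H ^ 3 * suc v ^ e        ≤⟨ *-monoʳ-≤ (H ^ 3) (^-monoˡ-≤ e 1+v≤2v) ⟩
    H ^ 3 * (2 * v) ^ e      ≡⟨ cong (H ^ 3 *_) (^-distribʳ-* 2 v e) ⟩
    H ^ 3 * (2 ^ e * v ^ e)  ≡⟨ *-assoc (H ^ 3) (2 ^ e) (v ^ e) ⟨
    K * v ^ e                ≤⟨ *-monoˡ-≤ (v ^ e) (≤-trans (m≤m+n K (2 * A)) (<⇒≤ C≤v)) ⟩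
    v ^ D                    ≤⟨ <⇒≤ vᴰ<n ⟩
    n                        ≤⟨ m≤n*m n 6 ⟩
    6 * n                    ∎
    where
    open ≤-Reasoning
    e = suc ℓ * 3
    1+v≤2v : suc v ≤ 2 * v
    1+v≤2v = subst (suc v ≤_) (cong (v +_) (sym (+-identityʳ v))) (+-monoˡ-≤ v (1≤v C≤v))

  n^E≤f^D : ∀ {n v t} → n ≤ suc v ^ D → ((3 + t) * blockSize v) ^ 3 ≤ 6 * n → n ^ E v t ≤ f n ^ D
  n^E≤f^D {n} {v} {t} n≤uᴰ fits = begin
    n ^ E v t        ≤⟨ ^-monoˡ-≤ (E v t) n≤uᴰ ⟩
    (u ^ D) ^ E v t  ≡⟨ ^-*-assoc u D (E v t) ⟩
    u ^ (D * E v t)  ≡⟨ cong (u ^_) (*-comm D (E v t)) ⟩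
    u ^ (E v t * D)  ≡⟨ ^-*-assoc u (E v t) D ⟨
    (u ^ E v t) ^ D  ≤⟨ ^-monoˡ-≤ D uᴱ≤f ⟩
    f n ^ D          ∎
    where
    open ≤-Reasoning
    u = suc v
    a = u ^ ℓ
    uᴱ≤f : u ^ E v t ≤ f n
    uᴱ≤f = begin
      u ^ (ℓ * (v * a) * t)    ≡⟨ ^-*-assoc u (ℓ * (v * a)) t ⟨
      (u ^ (ℓ * (v * a))) ^ t  ≡⟨ cong (_^ t) (^-*-assoc u ℓ (v * a)) ⟨
      (a ^ (v * a)) ^ t        ≤⟨ ^-monoˡ-≤ t (m^n≤[m+n]! a (v * a)) ⟩
      (blockSize v !) ^ t      ≤⟨ factorial^t≤f {n} (blockSize v) t (m^n>0 u (suc ℓ)) fits ⟩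
      f n                      ∎

  exponent-ratio : ∀ {n v t} → C ≤ v → H ≤ 3 + t → 6 * n < ((4 + t) * blockSize v) ^ 3 →
                   6 * k ^ 3 * n * D ^ 3 ≤ 27 * suc k ^ 3 * E v t ^ 3
  exponent-ratio {n} {v} {t} C≤v H≤3+t 6n<cube = begin
    6 * k ^ 3 * n * D ^ 3            ≡⟨ regroup k n D ⟩
    (k * D) ^ 3 * (6 * n)            ≤⟨ *-monoʳ-≤ ((k * D) ^ 3) (<⇒≤ 6n<cube) ⟩
    (k * D) ^ 3 * ((4 + t) * b) ^ 3  ≡⟨ ^-distribʳ-* (k * D) ((4 + t) * b) 3 ⟨
    (k * D * ((4 + t) * b)) ^ 3      ≤⟨ ^-monoˡ-≤ 3 kD[4+t]b≤[3+3k]E ⟩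
    ((3 + 3 * k) * E v t) ^ 3        ≡⟨ ^-distribʳ-* (3 + 3 * k) (E v t) 3 ⟩
    (3 + 3 * k) ^ 3 * E v t ^ 3      ≡⟨ cong (_* E v t ^ 3) (cube k) ⟩
    27 * suc k ^ 3 * E v t ^ 3       ∎
    where
    open ≤-Reasoning
    a = suc v ^ ℓ
    b = blockSize v
    regroup : ∀ k n d → 6 * (k * (k * (k * 1))) * n * (d * (d * (d * 1))) ≡ k * d * (k * d * (k * d * 1)) * (6 * n)
    regroup = solve-∀
    cube : ∀ k → (3 + 3 * k) * ((3 + 3 * k) * ((3 + 3 * k) * 1)) ≡ 27 * (suc k * (suc k * (suc k * 1)))
    cube = solve-∀
    reassocˡ : ∀ k d t v a → k * d * ((4 + t) * (suc v * a)) ≡ k * d * (4 + t) * suc v * a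
    reassocˡ = solve-∀
    reassocʳ : ∀ c l t v a → c * l * v * t * a ≡ c * (l * (v * a) * t)
    reassocʳ = solve-∀
    B≡1+A+2[1+k] : ∀ k → (3 + 3 * k) * (2 * k + 1) ≡ suc (k * suc (suc (2 * k + 1) * 3)) + 2 * suc k
    B≡1+A+2[1+k] = solve-∀
    16A≤t : 16 * A ≤ t
    16A≤t = +-cancelˡ-≤ 3 _ _ (subst (_≤ 3 + t) (+-comm (16 * A) 3) H≤3+t)
    kD[4+t]b≤[3+3k]E : k * D * ((4 + t) * b) ≤ (3 + 3 * k) * E v t
    kD[4+t]b≤[3+3k]E = begin
      k * D * ((4 + t) * b)        ≡⟨ reassocˡ k D t v a ⟩
      A * (4 + t) * suc v * a      ≤⟨ *-monoˡ-≤ a (A*[4+t]*[1+v]≤B*v*t A ((3 + 3 * k) * ℓ) t v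
                                        16A≤t (2A≤v C≤v) (1≤v C≤v)
                                        (subst (suc A ≤_) (sym (B≡1+A+2[1+k] k)) (m≤m+n (suc A) _))) ⟩
      (3 + 3 * k) * ℓ * v * t * a  ≡⟨ reassocʳ (3 + 3 * k) ℓ t v a ⟩
      (3 + 3 * k) * E v t          ∎

lemma3 : ∀ (k : ℕ) → ∃[ N ] ∀ (n : ℕ) → N ≤ n →
           ∃[ D ] ∃[ E ] (0 < D
             × 6 * k ^ 3 * n * D ^ 3 ≤ 27 * (suc k) ^ 3 * E ^ 3
             × n ^ E ≤ f n ^ D)
lemma3 k = suc (C ^ D) , λ n Cᴰ<n →
  let v , C≤v , vᴰ<n , n≤uᴰ       = root-bracket (suc ℓ * 3) Cᴰ<n
      t , H≤3+t , fits , exceeds =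
        block-count-bracket {n} (m^n>0 (suc v) (suc ℓ)) (m≤n+m 3 (16 * A)) (H-blocks-fit C≤v vᴰ<n)
  in D , E v t , s≤s z≤n , exponent-ratio C≤v H≤3+t exceeds , n^E≤f^D n≤uᴰ fits
  where open Parameters k
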